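{- Let $K$ be a pure cubic field of Type II, written $K=\mathbf{Q}(\alpha)$ with $\alpha^3=m=ab^2$, $a,b$ relatively prime squarefree positive integers, $3\nmid m$, $m\equiv\pm1\pmod9$; let $\beta=\alpha^2/b$ and $\nu=(1\pm\alpha+\alpha^2)/3$ (sign as in $m\equiv\pm1\pmod 9$). For $x\in K$ let $x^\perp=j_{\mathbf{R}}(x)-\frac{\langle j_{\mathbf{R}}(x),j_{\mathbf{R}}(1)\rangle}{3}j_{\mathbf{R}}(1)$. Then $\{\nu^\perp,\beta^\perp\}$ is a basis of $\mathcal{O}_K^\perp=\{x^\perp:x\in\mathcal{O}_K\}$ whose Gram matrix is \[\begin{pmatrix}\dfrac{\alpha^2(1+\alpha^2)}{3}&\dfrac{\alpha^4}{b}\\[2mm]\dfrac{\alpha^4}{b}&\dfrac{3\alpha^4}{b^2}\end{pmatrix},\] where in the matrix $\alpha$ denotes the real cube root $m^{1/3}$.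
   Context: Let $\omega=e^{2\pi i/3}$, $\sigma$ the real embedding of $K$, $\tau$ the complex embedding with $\tau(\alpha)=\omega m^{1/3}$. $j_{\mathbf{R}}(x)=(\sigma(x),\operatorname{Re}\tau(x),\operatorname{Im}\tau(x))\in\mathbf{R}^3$, with $\mathbf{R}^3$ carrying the inner product $\langle u,v\rangle=u^T\mathrm{diag}(1,2,2)v$. $\mathcal{O}_K$ is the ring of integers of $K$, which has integral basis $\{1,\nu,\beta\}$ in this case. -}

module Defs where

open import Data.Nat as ℕ using (ℕ; NonZero)
open import Data.Nat.Divisibility using (_∣_)
open import Data.Integer as ℤ using (ℤ; +_)
open import Data.Rational as ℚ using (ℚ; 0ℚ; 1ℚ; ½)
open import Data.Sign using (Sign)
open import Data.Product using (Σ; _×_; ∃; ∃-syntax; _,_)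
open import Relation.Binary.PropositionalEquality using (_≡_)

fromℤQ : ℤ → ℚ
fromℤQ z = z ℚ./ 1

Squarefree : ℕ → Set
Squarefree n = ∀ (d : ℕ) → d ℕ.* d ∣ n → d ≡ 1

-- Q(α) with α³ = m, elements c0 + c1 α + c2 α² (rational coordinates).
-- Used both for the abstract field K = Q(α) and (since the real cube
-- root m^{1/3} generates the isomorphic real subfield σ(K) ⊂ ℝ) for the
-- real numbers that occur.
record Cub : Set where
  constructor cub
  field
    c0 c1 c2 : ℚ
open Cub public

module _ (m : ℕ) where
  private mq = fromℤQ (+ m)

  cub0 cub1 cubα : Cub
  cub0 = cub 0ℚ 0ℚ 0ℚ
  cub1 = cub 1ℚ 0ℚ 0ℚ
  cubα = cub 0ℚ 1ℚ 0ℚ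

  cubq : ℚ → Cub
  cubq q = cub q 0ℚ 0ℚ

  _⊕_ : Cub → Cub → Cub
  cub x0 x1 x2 ⊕ cub y0 y1 y2 = cub (x0 ℚ.+ y0) (x1 ℚ.+ y1) (x2 ℚ.+ y2)

  ⊖_ : Cub → Cub
  ⊖ cub x0 x1 x2 = cub (ℚ.- x0) (ℚ.- x1) (ℚ.- x2)

  -- multiplication modulo α³ = m
  _⊗_ : Cub → Cub → Cub
  cub x0 x1 x2 ⊗ cub y0 y1 y2 =
    cub (x0 ℚ.* y0 ℚ.+ mq ℚ.* (x1 ℚ.* y2 ℚ.+ x2 ℚ.* y1))
        (x0 ℚ.* y1 ℚ.+ x1 ℚ.* y0 ℚ.+ mq ℚ.* (x2 ℚ.* y2))
        (x0 ℚ.* y2 ℚ.+ x1 ℚ.* y1 ℚ.+ x2 ℚ.* y0)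

  -- The real field Q(m^{1/3}, √3) ⊂ ℝ : elements r + s √3 with r s ∈ Q(m^{1/3}).
  -- All coordinates of j_ℝ(x), x ∈ K, lie in it.
  record Re : Set where
    constructor re
    field
      rat sq3 : Cub

  R0 R1 : Re
  R0 = re cub0 cub0
  R1 = re cub1 cub0

  Rα : Re
  Rα = re cubα cub0

  Rq : ℚ → Re
  Rq q = re (cubq q) cub0

  Rz : ℤ → Re
  Rz z = Rq (fromℤQ z)

  _+R_ : Re → Re → Re
  re a b +R re c d = re (a ⊕ c) (b ⊕ d)

  -R_ : Re → Re
  -R re a b = re (⊖ a) (⊖ b)

  _-R_ : Re → Re → Re
  x -R y = x +R (-R y)

  _*R_ : Re → Re → Re
  re a b *R re c d = re ((a ⊗ c) ⊕ (cub (fromℤQ (+ 3)) 0ℚ 0ℚ ⊗ (b ⊗ d))) ((a ⊗ d) ⊕ (b ⊗ c))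

  record Cx : Set where
    constructor cx
    field
      reP imP : Re

  _+C_ : Cx → Cx → Cx
  cx a b +C cx c d = cx (a +R c) (b +R d)

  _*C_ : Cx → Cx → Cx
  cx a b *C cx c d = cx ((a *R c) -R (b *R d)) ((a *R d) +R (b *R c))

  ofR : Re → Cx
  ofR r = cx r R0

  -- ω = e^{2πi/3} = -1/2 + (√3/2) i
  ω : Cx
  ω = cx (Rq (ℚ.- ½)) (re cub0 (cubq ½))

  σ : Cub → Re
  σ (cub x0 x1 x2) = (Rq x0 +R (Rq x1 *R Rα)) +R (Rq x2 *R (Rα *R Rα))

  τ : Cub → Cx
  τ (cub x0 x1 x2) =
    let t = ω *C ofR Rα in
    (ofR (Rq x0) +C (ofR (Rq x1) *C t)) +C (ofR (Rq x2) *C (t *C t))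

  record V3 : Set where
    constructor v3
    field
      v₁ v₂ v₃ : Re

  _+V_ : V3 → V3 → V3
  v3 a b c +V v3 d e f = v3 (a +R d) (b +R e) (c +R f)

  _·V_ : Re → V3 → V3
  r ·V v3 a b c = v3 (r *R a) (r *R b) (r *R c)

  V0 : V3
  V0 = v3 R0 R0 R0

  ⟪_,_⟫ : V3 → V3 → Re
  ⟪ v3 a b c , v3 d e f ⟫ = ((a *R d) +R (Rz (+ 2) *R (b *R e))) +R (Rz (+ 2) *R (c *R f))

  jR : Cub → V3
  jR x = v3 (σ x) (Cx.reP (τ x)) (Cx.imP (τ x))

  perp : Cub → V3
  perp x = jR x +V ((-R (⟪ jR x , jR cub1 ⟫ *R Rq (+ 1 ℚ./ 3))) ·V jR cub1)

  signQ : Sign → ℚ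
  signQ Sign.+ = 1ℚ
  signQ Sign.- = ℚ.- 1ℚ

  βK : (b : ℕ) → .{{NonZero b}} → Cub
  βK b = cub 0ℚ 0ℚ (+ 1 ℚ./ b)

  νK : Sign → Cub
  νK s = cub (+ 1 ℚ./ 3) (signQ s ℚ.* (+ 1 ℚ./ 3)) (+ 1 ℚ./ 3)

  -- O_K, given by its integral basis {1, ν, β}
  InOK : Sign → (b : ℕ) → .{{NonZero b}} → Cub → Set
  InOK s b x = ∃[ p ] ∃[ q ] ∃[ r ]
    x ≡ (cubq (fromℤQ p) ⊕ (cubq (fromℤQ q) ⊗ νK s)) ⊕ (cubq (fromℤQ r) ⊗ βK b)

  InOKperp : Sign → (b : ℕ) → .{{NonZero b}} → V3 → Set
  InOKperp s b v = ∃[ x ] (InOK s b x × v ≡ perp x)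

  IsZBasis2 : (V3 → Set) → V3 → V3 → Set
  IsZBasis2 L u w =
    (L u × L w)
    × (∀ v → L v → ∃[ c ] ∃[ d ] v ≡ (Rz c ·V u) +V (Rz d ·V w))
    × (∀ (c d : ℤ) → (Rz c ·V u) +V (Rz d ·V w) ≡ V0 → (c ≡ + 0 × d ≡ + 0))

  SignMod9 : Sign → Set
  SignMod9 Sign.+ = m ℕ.% 9 ≡ 1
  SignMod9 Sign.- = m ℕ.% 9 ≡ 8

{-# OPTIONS --safe #-}
-- Write x = x0 + x1 α + x2 α².  Since τ(α) = ω α with ω = -1/2 + (√3/2) i,
-- j_ℝ(x) is explicit, and ⟨j_ℝ(x), j_ℝ(1)⟩ = Tr x = 3 x0; hence
-- x^⊥ = j_ℝ(x1 α + x2 α²) depends only, and linearly, on (x1, x2).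
-- For x = p + q ν + r β these coordinates are (±q/3, q/3 + r/b), so
-- x^⊥ = q ν^⊥ + r β^⊥, and the triangular matrix (±1/3, 1/3; 0, 1/b) makes
-- ν^⊥, β^⊥ independent over ℤ.  The Gram form is
-- ⟨x^⊥, y^⊥⟩ = 3 (x1 y1 α² + x2 y2 α⁴), which gives the matrix.
module Submission where

open import Defs
open import Data.Nat as ℕ using (ℕ; NonZero; _<_; _*_)
open import Data.Nat.Divisibility using (_∣_)
open import Data.Nat.Coprimality using (Coprime)
open import Data.Integer as ℤ using (ℤ; +_)
open import Data.Integer.GCD using (gcd)
open import Data.Rational as ℚ using (ℚ; 0ℚ; 1ℚ; ½; _/_)
import Data.Rational.Properties as ℚP
open import Data.Sign using (Sign)
open import Data.Product using (_×_; _,_; proj₁; proj₂; ∃-syntax)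
open import Data.Maybe using (Maybe; just; nothing)
open import Data.Vec using (Vec; []; _∷_)
open import Data.Fin using (#_)
open import Function using (_∘_)
open import Relation.Nullary using (¬_; yes; no)
open import Relation.Binary.PropositionalEquality
open import Tactic.RingSolver.Core.AlmostCommutativeRing using (fromCommutativeRing)
open import Tactic.RingSolver.Core.Expression using (Expr)
  renaming (_⊕_ to _:+_; _⊗_ to _:*_; ⊝_ to :-_; Κ to con; Ι to var)

*-cancelʳ-≡0 : ∀ p q .{{_ : ℚ.NonZero q}} → p ℚ.* q ≡ 0ℚ → p ≡ 0ℚ
*-cancelʳ-≡0 p q pq≡0 = begin
  p                       ≡⟨ sym (ℚP.*-identityʳ p) ⟩
  p ℚ.* 1ℚ                ≡⟨ cong (p ℚ.*_) (sym (ℚP.*-inverseʳ q)) ⟩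
  p ℚ.* (q ℚ.* ℚ.1/ q)    ≡⟨ sym (ℚP.*-assoc p q (ℚ.1/ q)) ⟩
  (p ℚ.* q) ℚ.* ℚ.1/ q    ≡⟨ cong (ℚ._* ℚ.1/ q) pq≡0 ⟩
  0ℚ ℚ.* ℚ.1/ q           ≡⟨ ℚP.*-zeroˡ (ℚ.1/ q) ⟩
  0ℚ                      ∎
  where open ≡-Reasoning

fromℤQ≡0⇒≡0 : ∀ c → fromℤQ c ≡ 0ℚ → c ≡ + 0
fromℤQ≡0⇒≡0 c c/1≡0 =
  trans (sym (ℚP.↥-/ c 1)) (cong (ℤ._* gcd c (+ 1)) (ℚP.p≡0⇒↥p≡0 (fromℤQ c) c/1≡0))

triangular-kernel : ∀ {c d a b e} .{{_ : ℚ.NonZero a}} .{{_ : ℚ.NonZero e}} →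
                    c ℚ.* a ℚ.+ d ℚ.* 0ℚ ≡ 0ℚ → c ℚ.* b ℚ.+ d ℚ.* e ≡ 0ℚ → c ≡ 0ℚ × d ≡ 0ℚ
triangular-kernel {c} {d} {a} {b} {e} first second = c≡0 , d≡0
  where
  open ≡-Reasoning
  c≡0 : c ≡ 0ℚ
  c≡0 = *-cancelʳ-≡0 c a (begin
    c ℚ.* a                 ≡⟨ sym (ℚP.+-identityʳ (c ℚ.* a)) ⟩
    c ℚ.* a ℚ.+ 0ℚ          ≡⟨ cong (c ℚ.* a ℚ.+_) (sym (ℚP.*-zeroʳ d)) ⟩
    c ℚ.* a ℚ.+ d ℚ.* 0ℚ    ≡⟨ first ⟩
    0ℚ                      ∎)
  d≡0 : d ≡ 0ℚ
  d≡0 = *-cancelʳ-≡0 d e (begin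
    d ℚ.* e                 ≡⟨ sym (ℚP.+-identityˡ (d ℚ.* e)) ⟩
    0ℚ ℚ.+ d ℚ.* e          ≡⟨ cong (ℚ._+ d ℚ.* e) (sym (trans (cong (ℚ._* b) c≡0) (ℚP.*-zeroˡ b))) ⟩
    c ℚ.* b ℚ.+ d ℚ.* e     ≡⟨ second ⟩
    0ℚ                      ∎)

zero? : (x : ℚ) → Maybe (0ℚ ≡ x)
zero? x with 0ℚ ℚP.≟ x
... | yes p = just p
... | no _  = nothing

open import Tactic.RingSolver.NonReflective (fromCommutativeRing ℚP.+-*-commutativeRing zero?)
  using (module Ops)

-- j_ℝ(x0 + x1 α + x2 α²), read off from ω α = -α/2 + (√3/2) α i.
jR′ : (m : ℕ) → ℚ → ℚ → ℚ → V3 m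
jR′ m x0 x1 x2 =
  v3 (re (cub x0 x1 x2) (cub0 m))
     (re (cub x0 (ℚ.- ½ ℚ.* x1) (ℚ.- ½ ℚ.* x2)) (cub0 m))
     (re (cub0 m) (cub 0ℚ (½ ℚ.* x1) (ℚ.- ½ ℚ.* x2)))

ωα ω²α² : (m : ℕ) → Cx m
ωα   m = cx (re (cub 0ℚ (ℚ.- ½) 0ℚ) (cub0 m)) (re (cub0 m) (cub 0ℚ ½ 0ℚ))
ω²α² m = cx (re (cub 0ℚ 0ℚ (ℚ.- ½)) (cub0 m)) (re (cub0 m) (cub 0ℚ 0ℚ (ℚ.- ½)))

-- Each operation of Defs on Cub, Re, Cx and V3 has a twin (marked ᴱ) on
-- polynomial expressions with the same defining clauses, so interpreting a
-- twin term gives the original term definitionally.  An identity between such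
-- terms is then proved by the ring solver, one rational coordinate at a time.
module Reification {n : ℕ} (m̂ : Expr ℚ n) where

  record CubE : Set where
    constructor cubE
    field c0 c1 c2 : Expr ℚ n

  record ReE : Set where
    constructor reE
    field rat sq3 : CubE

  record CxE : Set where
    constructor cxE
    field reP imP : ReE

  record V3E : Set where
    constructor v3E
    field v₁ v₂ v₃ : ReE

  cub0ᴱ cub1ᴱ cubαᴱ : CubE
  cub0ᴱ = cubE (con 0ℚ) (con 0ℚ) (con 0ℚ)
  cub1ᴱ = cubE (con 1ℚ) (con 0ℚ) (con 0ℚ)
  cubαᴱ = cubE (con 0ℚ) (con 1ℚ) (con 0ℚ)

  cubqᴱ : Expr ℚ n → CubE
  cubqᴱ q = cubE q (con 0ℚ) (con 0ℚ)

  _⊕ᴱ_ : CubE → CubE → CubE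
  cubE x0 x1 x2 ⊕ᴱ cubE y0 y1 y2 = cubE (x0 :+ y0) (x1 :+ y1) (x2 :+ y2)

  ⊖ᴱ_ : CubE → CubE
  ⊖ᴱ cubE x0 x1 x2 = cubE (:- x0) (:- x1) (:- x2)

  _⊗ᴱ_ : CubE → CubE → CubE
  cubE x0 x1 x2 ⊗ᴱ cubE y0 y1 y2 =
    cubE (x0 :* y0 :+ m̂ :* (x1 :* y2 :+ x2 :* y1))
         (x0 :* y1 :+ x1 :* y0 :+ m̂ :* (x2 :* y2))
         (x0 :* y2 :+ x1 :* y1 :+ x2 :* y0)

  R0ᴱ R1ᴱ Rαᴱ : ReE
  R0ᴱ = reE cub0ᴱ cub0ᴱ
  R1ᴱ = reE cub1ᴱ cub0ᴱ
  Rαᴱ = reE cubαᴱ cub0ᴱ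

  Rqᴱ : Expr ℚ n → ReE
  Rqᴱ q = reE (cubqᴱ q) cub0ᴱ

  _+Rᴱ_ : ReE → ReE → ReE
  reE a b +Rᴱ reE c d = reE (a ⊕ᴱ c) (b ⊕ᴱ d)

  -Rᴱ_ : ReE → ReE
  -Rᴱ reE a b = reE (⊖ᴱ a) (⊖ᴱ b)

  _-Rᴱ_ : ReE → ReE → ReE
  x -Rᴱ y = x +Rᴱ (-Rᴱ y)

  _*Rᴱ_ : ReE → ReE → ReE
  reE a b *Rᴱ reE c d =
    reE ((a ⊗ᴱ c) ⊕ᴱ (cubE (con (fromℤQ (+ 3))) (con 0ℚ) (con 0ℚ) ⊗ᴱ (b ⊗ᴱ d)))
        ((a ⊗ᴱ d) ⊕ᴱ (b ⊗ᴱ c))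

  _+Cᴱ_ : CxE → CxE → CxE
  cxE a b +Cᴱ cxE c d = cxE (a +Rᴱ c) (b +Rᴱ d)

  _*Cᴱ_ : CxE → CxE → CxE
  cxE a b *Cᴱ cxE c d = cxE ((a *Rᴱ c) -Rᴱ (b *Rᴱ d)) ((a *Rᴱ d) +Rᴱ (b *Rᴱ c))

  ofRᴱ : ReE → CxE
  ofRᴱ r = cxE r R0ᴱ

  ωᴱ : CxE
  ωᴱ = cxE (Rqᴱ (con (ℚ.- ½))) (reE cub0ᴱ (cubqᴱ (con ½)))

  σᴱ : CubE → ReE
  σᴱ (cubE x0 x1 x2) = (Rqᴱ x0 +Rᴱ (Rqᴱ x1 *Rᴱ Rαᴱ)) +Rᴱ (Rqᴱ x2 *Rᴱ (Rαᴱ *Rᴱ Rαᴱ))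

  _+Vᴱ_ : V3E → V3E → V3E
  v3E a b c +Vᴱ v3E d e f = v3E (a +Rᴱ d) (b +Rᴱ e) (c +Rᴱ f)

  _·Vᴱ_ : ReE → V3E → V3E
  r ·Vᴱ v3E a b c = v3E (r *Rᴱ a) (r *Rᴱ b) (r *Rᴱ c)

  ⟪_,_⟫ᴱ : V3E → V3E → ReE
  ⟪ v3E a b c , v3E d e f ⟫ᴱ =
    ((a *Rᴱ d) +Rᴱ (Rqᴱ (con (fromℤQ (+ 2))) *Rᴱ (b *Rᴱ e)))
      +Rᴱ (Rqᴱ (con (fromℤQ (+ 2))) *Rᴱ (c *Rᴱ f))

  ωαᴱ ω²α²ᴱ : CxE
  ωαᴱ   = cxE (reE (cubE (con 0ℚ) (con (ℚ.- ½)) (con 0ℚ)) cub0ᴱ)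
              (reE cub0ᴱ (cubE (con 0ℚ) (con ½) (con 0ℚ)))
  ω²α²ᴱ = cxE (reE (cubE (con 0ℚ) (con 0ℚ) (con (ℚ.- ½))) cub0ᴱ)
              (reE cub0ᴱ (cubE (con 0ℚ) (con 0ℚ) (con (ℚ.- ½))))

  jR′ᴱ : Expr ℚ n → Expr ℚ n → Expr ℚ n → V3E
  jR′ᴱ x0 x1 x2 =
    v3E (reE (cubE x0 x1 x2) cub0ᴱ)
        (reE (cubE x0 (con (ℚ.- ½) :* x1) (con (ℚ.- ½) :* x2)) cub0ᴱ)
        (reE cub0ᴱ (cubE (con 0ℚ) (con ½ :* x1) (con (ℚ.- ½) :* x2)))

  module Interpretation (m : ℕ) (⟦_⟧ : Expr ℚ n → ℚ) where
    ⟦_⟧C : CubE → Cub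
    ⟦ cubE a b c ⟧C = cub ⟦ a ⟧ ⟦ b ⟧ ⟦ c ⟧

    ⟦_⟧R : ReE → Re m
    ⟦ reE a b ⟧R = re ⟦ a ⟧C ⟦ b ⟧C

    ⟦_⟧X : CxE → Cx m
    ⟦ cxE a b ⟧X = cx ⟦ a ⟧R ⟦ b ⟧R

    ⟦_⟧V : V3E → V3 m
    ⟦ v3E a b c ⟧V = v3 ⟦ a ⟧R ⟦ b ⟧R ⟦ c ⟧R

  module Componentwise (m : ℕ) {f g : Expr ℚ n → ℚ}
                       (transfer : ∀ p q → f p ≡ f q → g p ≡ g q) where
    private
      module F = Interpretation m f
      module G = Interpretation m g

    cub-transfer : ∀ X Y → F.⟦ X ⟧C ≡ F.⟦ Y ⟧C → G.⟦ X ⟧C ≡ G.⟦ Y ⟧C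
    cub-transfer (cubE a b c) (cubE a′ b′ c′) h
      rewrite transfer a a′ (cong c0 h) | transfer b b′ (cong c1 h) | transfer c c′ (cong c2 h) = refl

    re-transfer : ∀ X Y → F.⟦ X ⟧R ≡ F.⟦ Y ⟧R → G.⟦ X ⟧R ≡ G.⟦ Y ⟧R
    re-transfer (reE a b) (reE a′ b′) h =
      cong₂ re (cub-transfer a a′ (cong Re.rat h)) (cub-transfer b b′ (cong Re.sq3 h))

    cx-transfer : ∀ X Y → F.⟦ X ⟧X ≡ F.⟦ Y ⟧X → G.⟦ X ⟧X ≡ G.⟦ Y ⟧X
    cx-transfer (cxE a b) (cxE a′ b′) h =
      cong₂ cx (re-transfer a a′ (cong Cx.reP h)) (re-transfer b b′ (cong Cx.imP h))

    v3-transfer : ∀ X Y → F.⟦ X ⟧V ≡ F.⟦ Y ⟧V → G.⟦ X ⟧V ≡ G.⟦ Y ⟧V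
    v3-transfer (v3E a b c) (v3E a′ b′ c′) h
      rewrite re-transfer a a′ (cong V3.v₁ h) | re-transfer b b′ (cong V3.v₂ h)
            | re-transfer c c′ (cong V3.v₃ h) = refl

  module Solver (m : ℕ) (ρ : Vec ℚ n) where
    open Interpretation m (λ p → Ops.⟦ p ⟧ ρ) public
    open Componentwise m {λ p → Ops.⟦ p ⇓⟧ ρ} {λ p → Ops.⟦ p ⟧ ρ}
      (λ p q h → trans (sym (Ops.correct p ρ)) (trans h (Ops.correct q ρ)))
      renaming (cub-transfer to cub-solve; re-transfer to re-solve;
                cx-transfer to cx-solve; v3-transfer to v3-solve) public

module Embedding (m : ℕ) where
  private
    mq : ℚ
    mq = fromℤQ (+ m)

  module _ where
    open Reification {1} (var (# 0))
    open Solver m (mq ∷ [])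

    ω*α≡ωα : _*C_ m (ω m) (ofR m (Rα m)) ≡ ωα m
    ω*α≡ωα = cx-solve (ωᴱ *Cᴱ ofRᴱ Rαᴱ) ωαᴱ refl

    ωα*ωα≡ω²α² : _*C_ m (ωα m) (ωα m) ≡ ω²α² m
    ωα*ωα≡ω²α² = cx-solve (ωαᴱ *Cᴱ ωαᴱ) ω²α²ᴱ refl

  module _ (x0 x1 x2 : ℚ) where
    open Reification {4} (var (# 3))
    open Solver m (x0 ∷ x1 ∷ x2 ∷ mq ∷ [])

    private
      x̂0 x̂1 x̂2 : Expr ℚ 4
      x̂0 = var (# 0)
      x̂1 = var (# 1)
      x̂2 = var (# 2)

      τ-in : Cx m → Cx m → Cx m
      τ-in t t² = _+C_ m (_+C_ m (ofR m (Rq m x0)) (_*C_ m (ofR m (Rq m x1)) t)) (_*C_ m (ofR m (Rq m x2)) t²)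

    τ≡ : τ m (cub x0 x1 x2) ≡ cx (V3.v₂ (jR′ m x0 x1 x2)) (V3.v₃ (jR′ m x0 x1 x2))
    τ≡ = begin
      τ-in (ω m *α) (_*C_ m (ω m *α) (ω m *α))   ≡⟨ cong (λ t → τ-in t (_*C_ m t t)) ω*α≡ωα ⟩
      τ-in (ωα m) (_*C_ m (ωα m) (ωα m))         ≡⟨ cong (τ-in (ωα m)) ωα*ωα≡ω²α² ⟩
      τ-in (ωα m) (ω²α² m)
        ≡⟨ cx-solve ((ofRᴱ (Rqᴱ x̂0) +Cᴱ (ofRᴱ (Rqᴱ x̂1) *Cᴱ ωαᴱ)) +Cᴱ (ofRᴱ (Rqᴱ x̂2) *Cᴱ ω²α²ᴱ))
                    (cxE (V3E.v₂ (jR′ᴱ x̂0 x̂1 x̂2)) (V3E.v₃ (jR′ᴱ x̂0 x̂1 x̂2))) refl ⟩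
      cx (V3.v₂ (jR′ m x0 x1 x2)) (V3.v₃ (jR′ m x0 x1 x2)) ∎
      where
      open ≡-Reasoning
      _*α : Cx m → Cx m
      z *α = _*C_ m z (ofR m (Rα m))

    jR≡jR′ : jR m (cub x0 x1 x2) ≡ jR′ m x0 x1 x2
    jR≡jR′ = begin
      v3 (σ m x) (Cx.reP (τ m x)) (Cx.imP (τ m x))
        ≡⟨ cong (λ z → v3 (σ m x) (Cx.reP z) (Cx.imP z)) τ≡ ⟩
      v3 (σ m x) (V3.v₂ (jR′ m x0 x1 x2)) (V3.v₃ (jR′ m x0 x1 x2))
        ≡⟨ v3-solve (v3E (σᴱ (cubE x̂0 x̂1 x̂2)) (V3E.v₂ (jR′ᴱ x̂0 x̂1 x̂2)) (V3E.v₃ (jR′ᴱ x̂0 x̂1 x̂2)))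
                    (jR′ᴱ x̂0 x̂1 x̂2) refl ⟩
      jR′ m x0 x1 x2 ∎
      where
      open ≡-Reasoning
      x = cub x0 x1 x2

    ⟪jR′,jR′1⟫ : ⟪_,_⟫ m (jR′ m x0 x1 x2) (jR′ m 1ℚ 0ℚ 0ℚ) ≡ Rq m (fromℤQ (+ 3) ℚ.* x0)
    ⟪jR′,jR′1⟫ = re-solve ⟪ jR′ᴱ x̂0 x̂1 x̂2 , jR′ᴱ (con 1ℚ) (con 0ℚ) (con 0ℚ) ⟫ᴱ
                          (Rqᴱ (con (fromℤQ (+ 3)) :* x̂0)) refl

  private
    remove-trace : V3 m → V3 m → Re m → V3 m
    remove-trace x′ e t = _+V_ m x′ (_·V_ m (-R_ m (_*R_ m t (Rq m (+ 1 / 3)))) e)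

  -- The implicit arguments of cong₂ are given so that the conversion checker
  -- never has to unfold jR or perp, whose normal forms are huge.
  perp≡jR′ : ∀ x → perp m x ≡ jR′ m 0ℚ (c1 x) (c2 x)
  perp≡jR′ x@(cub x0 x1 x2) = begin
    remove-trace (jR m x) (jR m (cub1 m)) (⟪_,_⟫ m (jR m x) (jR m (cub1 m)))
      ≡⟨ cong₂ (λ x′ e → remove-trace x′ e (⟪_,_⟫ m x′ e))
               {x = jR m x} {y = jR′ m x0 x1 x2} {u = jR m (cub1 m)} {v = jR′ m 1ℚ 0ℚ 0ℚ}
               (jR≡jR′ x0 x1 x2) (jR≡jR′ 1ℚ 0ℚ 0ℚ) ⟩
    remove-trace (jR′ m x0 x1 x2) (jR′ m 1ℚ 0ℚ 0ℚ) (⟪_,_⟫ m (jR′ m x0 x1 x2) (jR′ m 1ℚ 0ℚ 0ℚ))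
      ≡⟨ cong (remove-trace (jR′ m x0 x1 x2) (jR′ m 1ℚ 0ℚ 0ℚ)) (⟪jR′,jR′1⟫ x0 x1 x2) ⟩
    remove-trace (jR′ m x0 x1 x2) (jR′ m 1ℚ 0ℚ 0ℚ) (Rq m (fromℤQ (+ 3) ℚ.* x0))
      ≡⟨ v3-solve (jR′ᴱ x̂0 x̂1 x̂2 +Vᴱ ((-Rᴱ (Rqᴱ (con (fromℤQ (+ 3)) :* x̂0) *Rᴱ Rqᴱ (con (+ 1 / 3))))
                                       ·Vᴱ jR′ᴱ (con 1ℚ) (con 0ℚ) (con 0ℚ)))
                  (jR′ᴱ (con 0ℚ) x̂1 x̂2) refl ⟩
    jR′ m 0ℚ x1 x2 ∎
    where
    open ≡-Reasoning
    open Reification {4} (var (# 3))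
    open Solver m (x0 ∷ x1 ∷ x2 ∷ mq ∷ [])
    x̂0 x̂1 x̂2 : Expr ℚ 4
    x̂0 = var (# 0)
    x̂1 = var (# 1)
    x̂2 = var (# 2)

  α² α⁴ : Re m
  α² = _*R_ m (Rα m) (Rα m)
  α⁴ = _*R_ m α² α²

  ⟪jR′,jR′⟫ : ∀ a b a′ b′ →
              ⟪_,_⟫ m (jR′ m 0ℚ a b) (jR′ m 0ℚ a′ b′)
              ≡ _+R_ m (_*R_ m (Rq m (fromℤQ (+ 3) ℚ.* (a ℚ.* a′))) α²)
                       (_*R_ m (Rq m (fromℤQ (+ 3) ℚ.* (b ℚ.* b′))) α⁴)
  ⟪jR′,jR′⟫ a b a′ b′ =
    re-solve ⟪ jR′ᴱ (con 0ℚ) â b̂ , jR′ᴱ (con 0ℚ) â′ b̂′ ⟫ᴱ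
             ((Rqᴱ (con (fromℤQ (+ 3)) :* (â :* â′)) *Rᴱ α²ᴱ)
               +Rᴱ (Rqᴱ (con (fromℤQ (+ 3)) :* (b̂ :* b̂′)) *Rᴱ (α²ᴱ *Rᴱ α²ᴱ))) refl
    where
    open Reification {5} (var (# 4))
    open Solver m (a ∷ b ∷ a′ ∷ b′ ∷ mq ∷ [])
    â b̂ â′ b̂′ : Expr ℚ 5
    â  = var (# 0)
    b̂  = var (# 1)
    â′ = var (# 2)
    b̂′ = var (# 3)
    α²ᴱ : ReE
    α²ᴱ = Rαᴱ *Rᴱ Rαᴱ

  jR′-linear : ∀ c d a b a′ b′ →
               _+V_ m (_·V_ m (Rq m c) (jR′ m 0ℚ a b)) (_·V_ m (Rq m d) (jR′ m 0ℚ a′ b′))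
               ≡ jR′ m 0ℚ (c ℚ.* a ℚ.+ d ℚ.* a′) (c ℚ.* b ℚ.+ d ℚ.* b′)
  jR′-linear c d a b a′ b′ =
    v3-solve ((Rqᴱ ĉ ·Vᴱ jR′ᴱ (con 0ℚ) â b̂) +Vᴱ (Rqᴱ d̂ ·Vᴱ jR′ᴱ (con 0ℚ) â′ b̂′))
             (jR′ᴱ (con 0ℚ) (ĉ :* â :+ d̂ :* â′) (ĉ :* b̂ :+ d̂ :* b̂′)) refl
    where
    open Reification {7} (var (# 6))
    open Solver m (c ∷ d ∷ a ∷ b ∷ a′ ∷ b′ ∷ mq ∷ [])
    ĉ d̂ â b̂ â′ b̂′ : Expr ℚ 7
    ĉ  = var (# 0)
    d̂  = var (# 1)
    â  = var (# 2)
    b̂  = var (# 3)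
    â′ = var (# 4)
    b̂′ = var (# 5)

  ⟪perp,perp⟫ : ∀ x y →
                ⟪_,_⟫ m (perp m x) (perp m y)
                ≡ _+R_ m (_*R_ m (Rq m (fromℤQ (+ 3) ℚ.* (c1 x ℚ.* c1 y))) α²)
                         (_*R_ m (Rq m (fromℤQ (+ 3) ℚ.* (c2 x ℚ.* c2 y))) α⁴)
  ⟪perp,perp⟫ x y =
    trans (cong₂ (⟪_,_⟫ m) {x = perp m x} {y = jR′ m 0ℚ (c1 x) (c2 x)}
                           {u = perp m y} {v = jR′ m 0ℚ (c1 y) (c2 y)} (perp≡jR′ x) (perp≡jR′ y))
          (⟪jR′,jR′⟫ (c1 x) (c2 x) (c1 y) (c2 y))

⅓ : ℚ
⅓ = + 1 / 3

ν-α-coordinate : ℕ → Sign → ℚ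
ν-α-coordinate m s = signQ m s ℚ.* ⅓

ν-α-coordinate-nonZero : ∀ m s → ℚ.NonZero (ν-α-coordinate m s)
ν-α-coordinate-nonZero m Sign.+ = _
ν-α-coordinate-nonZero m Sign.- = _

3*ν-α-coordinate²≡⅓ : ∀ m s → fromℤQ (+ 3) ℚ.* (ν-α-coordinate m s ℚ.* ν-α-coordinate m s) ≡ ⅓
3*ν-α-coordinate²≡⅓ m Sign.+ = refl
3*ν-α-coordinate²≡⅓ m Sign.- = refl

-- In terms, βK m b always gets its instance argument explicitly: an unsolved
-- instance meta would make the conversion checker unfold perp (βK m b).
module TypeII (m b : ℕ) .{{b≢0 : NonZero b}} (s : Sign) where
  open Embedding m
  private
    mq : ℚ
    mq = fromℤQ (+ m)

  ν₁ b⁻¹ : ℚ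
  ν₁ = ν-α-coordinate m s
  b⁻¹ = + 1 / b

  b⁻¹-nonZero : ℚ.NonZero b⁻¹
  b⁻¹-nonZero = ℚP.pos⇒nonZero b⁻¹ {{ℚP.normalize-pos 1 b}}

  integral-combination : ℚ → ℚ → ℚ → Cub
  integral-combination p q r =
    _⊕_ m (_⊕_ m (cubq m p) (_⊗_ m (cubq m q) (νK m s))) (_⊗_ m (cubq m r) (βK m b {{b≢0}}))

  private
    module Ring (p q r : ℚ) where
      open Reification {6} (var (# 5)) public
      open Solver m (p ∷ q ∷ r ∷ ν₁ ∷ b⁻¹ ∷ mq ∷ []) public
      p̂ q̂ r̂ ν̂₁ b̂⁻¹ : Expr ℚ 6
      p̂   = var (# 0)
      q̂   = var (# 1)
      r̂   = var (# 2)
      ν̂₁  = var (# 3)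
      b̂⁻¹ = var (# 4)
      νᴱ βᴱ : CubE
      νᴱ = cubE (con ⅓) ν̂₁ (con ⅓)
      βᴱ = cubE (con 0ℚ) (con 0ℚ) b̂⁻¹
      integralᴱ : Expr ℚ 6 → Expr ℚ 6 → Expr ℚ 6 → CubE
      integralᴱ p q r = (cubqᴱ p ⊕ᴱ (cubqᴱ q ⊗ᴱ νᴱ)) ⊕ᴱ (cubqᴱ r ⊗ᴱ βᴱ)
      α²ᴱ α⁴ᴱ : ReE
      α²ᴱ = Rαᴱ *Rᴱ Rαᴱ
      α⁴ᴱ = α²ᴱ *Rᴱ α²ᴱ

  integral-combination-coordinates : ∀ p q r →
    integral-combination p q r ≡ cub (p ℚ.+ q ℚ.* ⅓) (q ℚ.* ν₁ ℚ.+ r ℚ.* 0ℚ) (q ℚ.* ⅓ ℚ.+ r ℚ.* b⁻¹)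
  integral-combination-coordinates p q r =
    cub-solve (integralᴱ p̂ q̂ r̂)
              (cubE (p̂ :+ q̂ :* con ⅓) (q̂ :* ν̂₁ :+ r̂ :* con 0ℚ) (q̂ :* con ⅓ :+ r̂ :* b̂⁻¹)) refl
    where open Ring p q r

  ν∈OK : InOK m s b (νK m s)
  ν∈OK = + 0 , + 1 , + 0 ,
    cub-solve νᴱ (integralᴱ (con (fromℤQ (+ 0))) (con (fromℤQ (+ 1))) (con (fromℤQ (+ 0)))) refl
    where open Ring 0ℚ 0ℚ 0ℚ

  β∈OK : InOK m s b (βK m b)
  β∈OK = + 0 , + 0 , + 1 ,
    cub-solve βᴱ (integralᴱ (con (fromℤQ (+ 0))) (con (fromℤQ (+ 0))) (con (fromℤQ (+ 1)))) refl
    where open Ring 0ℚ 0ℚ 0ℚ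

  perp-combination : ℤ → ℤ → V3 m
  perp-combination c d =
    _+V_ m (_·V_ m (Rz m c) (perp m (νK m s))) (_·V_ m (Rz m d) (perp m (βK m b {{b≢0}})))

  perp-combination≡jR′ : ∀ c d →
    perp-combination c d
    ≡ jR′ m 0ℚ (fromℤQ c ℚ.* ν₁ ℚ.+ fromℤQ d ℚ.* 0ℚ) (fromℤQ c ℚ.* ⅓ ℚ.+ fromℤQ d ℚ.* b⁻¹)
  perp-combination≡jR′ c d = trans
    (cong₂ (λ u v → _+V_ m (_·V_ m (Rz m c) u) (_·V_ m (Rz m d) v))
           {x = perp m (νK m s)} {y = jR′ m 0ℚ ν₁ ⅓}
           {u = perp m (βK m b {{b≢0}})} {v = jR′ m 0ℚ 0ℚ b⁻¹}
           (perp≡jR′ (νK m s)) (perp≡jR′ (βK m b {{b≢0}})))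
    (jR′-linear (fromℤQ c) (fromℤQ d) ν₁ ⅓ 0ℚ b⁻¹)

  perp-combination-injective : ∀ c d → perp-combination c d ≡ V0 m → c ≡ + 0 × d ≡ + 0
  perp-combination-injective c d c·ν+d·β≡0 =
    fromℤQ≡0⇒≡0 c (proj₁ c≡0×d≡0) , fromℤQ≡0⇒≡0 d (proj₂ c≡0×d≡0)
    where
    coordinates≡0 = trans (sym (perp-combination≡jR′ c d)) c·ν+d·β≡0
    c≡0×d≡0 = triangular-kernel {{ν-α-coordinate-nonZero m s}} {{b⁻¹-nonZero}}
                                (cong (c1 ∘ Re.rat ∘ V3.v₁) coordinates≡0)
                                (cong (c2 ∘ Re.rat ∘ V3.v₁) coordinates≡0)

  perp-combination-surjective : ∀ v → InOKperp m s b v → ∃[ c ] ∃[ d ] v ≡ perp-combination c d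
  perp-combination-surjective v (x , (p , q , r , x≡) , v≡x⊥) = q , r , (begin
    v                       ≡⟨ v≡x⊥ ⟩
    perp m x                ≡⟨ cong (perp m) {x = x} {y = y} x≡ ⟩
    perp m y                ≡⟨ perp≡jR′ y ⟩
    jR′ m 0ℚ (c1 y) (c2 y)
                            ≡⟨ cong (λ z → jR′ m 0ℚ (c1 z) (c2 z)) (integral-combination-coordinates p′ q′ r′) ⟩
    jR′ m 0ℚ (q′ ℚ.* ν₁ ℚ.+ r′ ℚ.* 0ℚ) (q′ ℚ.* ⅓ ℚ.+ r′ ℚ.* b⁻¹)
                            ≡⟨ sym (perp-combination≡jR′ q r) ⟩
    perp-combination q r    ∎)
    where
    open ≡-Reasoning
    p′ = fromℤQ p
    q′ = fromℤQ q
    r′ = fromℤQ r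
    y = integral-combination p′ q′ r′

  perp-basis : IsZBasis2 m (InOKperp m s b) (perp m (νK m s)) (perp m (βK m b))
  perp-basis =
    ((νK m s , ν∈OK , refl) , (βK m b {{b≢0}} , β∈OK , refl)) ,
    perp-combination-surjective , perp-combination-injective

  gram-νν : ⟪_,_⟫ m (perp m (νK m s)) (perp m (νK m s))
            ≡ _*R_ m α² (_*R_ m (_+R_ m (R1 m) α²) (Rq m ⅓))
  gram-νν = begin
    ⟪_,_⟫ m (perp m (νK m s)) (perp m (νK m s))
      ≡⟨ ⟪perp,perp⟫ (νK m s) (νK m s) ⟩
    _+R_ m (_*R_ m (Rq m (fromℤQ (+ 3) ℚ.* (ν₁ ℚ.* ν₁))) α²) (_*R_ m (Rq m (fromℤQ (+ 3) ℚ.* (⅓ ℚ.* ⅓))) α⁴)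
      ≡⟨ cong (λ t → _+R_ m (_*R_ m (Rq m t) α²) (_*R_ m (Rq m (fromℤQ (+ 3) ℚ.* (⅓ ℚ.* ⅓))) α⁴))
              (3*ν-α-coordinate²≡⅓ m s) ⟩
    _+R_ m (_*R_ m (Rq m ⅓) α²) (_*R_ m (Rq m (fromℤQ (+ 3) ℚ.* (⅓ ℚ.* ⅓))) α⁴)
      ≡⟨ re-solve ((Rqᴱ (con ⅓) *Rᴱ α²ᴱ) +Rᴱ (Rqᴱ (con (fromℤQ (+ 3)) :* (con ⅓ :* con ⅓)) *Rᴱ α⁴ᴱ))
                  (α²ᴱ *Rᴱ ((R1ᴱ +Rᴱ α²ᴱ) *Rᴱ Rqᴱ (con ⅓))) refl ⟩
    _*R_ m α² (_*R_ m (_+R_ m (R1 m) α²) (Rq m ⅓)) ∎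
    where
    open ≡-Reasoning
    open Ring 0ℚ 0ℚ 0ℚ

  gram-νβ : ⟪_,_⟫ m (perp m (νK m s)) (perp m (βK m b)) ≡ _*R_ m α⁴ (Rq m b⁻¹)
  gram-νβ = trans (⟪perp,perp⟫ (νK m s) (βK m b {{b≢0}}))
    (re-solve ((Rqᴱ (con (fromℤQ (+ 3)) :* (ν̂₁ :* con 0ℚ)) *Rᴱ α²ᴱ)
                 +Rᴱ (Rqᴱ (con (fromℤQ (+ 3)) :* (con ⅓ :* b̂⁻¹)) *Rᴱ α⁴ᴱ))
              (α⁴ᴱ *Rᴱ Rqᴱ b̂⁻¹) refl)
    where open Ring 0ℚ 0ℚ 0ℚ

  gram-βν : ⟪_,_⟫ m (perp m (βK m b)) (perp m (νK m s)) ≡ _*R_ m α⁴ (Rq m b⁻¹)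
  gram-βν = trans (⟪perp,perp⟫ (βK m b {{b≢0}}) (νK m s))
    (re-solve ((Rqᴱ (con (fromℤQ (+ 3)) :* (con 0ℚ :* ν̂₁)) *Rᴱ α²ᴱ)
                 +Rᴱ (Rqᴱ (con (fromℤQ (+ 3)) :* (b̂⁻¹ :* con ⅓)) *Rᴱ α⁴ᴱ))
              (α⁴ᴱ *Rᴱ Rqᴱ b̂⁻¹) refl)
    where open Ring 0ℚ 0ℚ 0ℚ

  gram-ββ : ⟪_,_⟫ m (perp m (βK m b)) (perp m (βK m b))
            ≡ _*R_ m α⁴ (_*R_ m (Rq m (+ 3 / 1)) (_*R_ m (Rq m b⁻¹) (Rq m b⁻¹)))
  gram-ββ = trans (⟪perp,perp⟫ (βK m b {{b≢0}}) (βK m b {{b≢0}}))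
    (re-solve ((Rqᴱ (con (fromℤQ (+ 3)) :* (con 0ℚ :* con 0ℚ)) *Rᴱ α²ᴱ)
                 +Rᴱ (Rqᴱ (con (fromℤQ (+ 3)) :* (b̂⁻¹ :* b̂⁻¹)) *Rᴱ α⁴ᴱ))
              (α⁴ᴱ *Rᴱ (Rqᴱ (con (+ 3 / 1)) *Rᴱ (Rqᴱ b̂⁻¹ *Rᴱ Rqᴱ b̂⁻¹))) refl)
    where open Ring 0ℚ 0ℚ 0ℚ

lemma2p4 : (a b m : ℕ) → .{{_ : NonZero b}} → (s : Sign) →
    0 < a → 0 < b → Squarefree a → Squarefree b → Coprime a b →
    m ≡ a * (b * b) → 1 < m → ¬ (3 ∣ m) → SignMod9 m s →
    IsZBasis2 m (InOKperp m s b) (perp m (νK m s)) (perp m (βK m b))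
    × ⟪_,_⟫ m (perp m (νK m s)) (perp m (νK m s))
        ≡ _*R_ m (_*R_ m (Rα m) (Rα m))
            (_*R_ m (_+R_ m (R1 m) (_*R_ m (Rα m) (Rα m))) (Rq m (+ 1 / 3)))
    × ⟪_,_⟫ m (perp m (νK m s)) (perp m (βK m b))
        ≡ _*R_ m (_*R_ m (_*R_ m (Rα m) (Rα m)) (_*R_ m (Rα m) (Rα m))) (Rq m (+ 1 / b))
    × ⟪_,_⟫ m (perp m (βK m b)) (perp m (νK m s))
        ≡ _*R_ m (_*R_ m (_*R_ m (Rα m) (Rα m)) (_*R_ m (Rα m) (Rα m))) (Rq m (+ 1 / b))
    × ⟪_,_⟫ m (perp m (βK m b)) (perp m (βK m b))
        ≡ _*R_ m (_*R_ m (_*R_ m (Rα m) (Rα m)) (_*R_ m (Rα m) (Rα m))) (_*R_ m (Rq m (+ 3 / 1)) (_*R_ m (Rq m (+ 1 / b)) (Rq m (+ 1 / b))))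
lemma2p4 a b m {{b≢0}} s _ _ _ _ _ _ _ _ _ = perp-basis , gram-νν , gram-νβ , gram-βν , gram-ββ
  where open TypeII m b {{b≢0}} s
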